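{- For $i=1$ and $i=2$, the categorical rewriting systems $\mathcal{R}_{\mathrm{fpbc},i}$ (based on final pullback complements) and $\mathcal{R}_{\mathrm{sqpo},i}$ (based on sesqui-pushouts) for graphs are functorial.
   Context: A categorical rewriting system consists of a span of categories $\mathcal{L}\xleftarrow{\mathbf{L}}\mathcal{P}\xrightarrow{\mathbf{R}}\mathcal{R}$ and, for each object $\rho$ of $\mathcal{P}$ (a rule), a partial function $S_\rho$ from morphisms of $\mathcal{L}$ with source $\mathbf{L}(\rho)$ to morphisms of $\mathcal{P}$ with source $\rho$, with $\mathbf{L}(S_\rho(f))=f$ for $f\in\mathrm{dom}(S_\rho)$. It is functorial if for every rule $\rho$ with $\mathbf{L}(\rho)=L$: (i) $\mathrm{id}_L\in\mathrm{dom}(S_\rho)$ and $S_\rho(\mathrm{id}_L)=\mathrm{id}_\rho$; (ii) for $f_1:L\to L_1$, $f_2:L_1\to L_2$ in $\mathcal{L}$, if $f_1\in\mathrm{dom}(S_\rho)$ and $f_2\in\mathrm{dom}(S_{\rho_1})$ with $\rho_1$ the target of $S_\rho(f_1)$, then $f_2\circ f_1\in\mathrm{dom}(S_\rho)$ and $S_{\rho_1}(f_2)\circ S_\rho(f_1)=S_\rho(f_2\circ f_1)$ (equalities up to isomorphism). Composition of systems $(\mathcal{L}\xleftarrow{\mathbf{L}}\mathcal{P}\xrightarrow{\mathbf{R}}\mathcal{R},S)$ and $(\mathcal{R}\xleftarrow{\mathbf{L}'}\mathcal{P}'\xrightarrow{\mathbf{R}'}\mathcal{R}',S')$: $\mathcal{P}''$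 is the pullback of $\mathbf{R}$ and $\mathbf{L}'$ (objects pairs $(\rho,\rho')$ with $\mathbf{R}(\rho)=\mathbf{L}'(\rho')$, morphisms pairs $(\pi,\pi')$ with $\mathbf{R}(\pi)=\mathbf{L}'(\pi')$), $\mathbf{L}''=\mathbf{L}\circ\mathrm{pr}_1$, $\mathbf{R}''=\mathbf{R}'\circ\mathrm{pr}_2$; $\mathrm{dom}(S''_{(\rho,\rho')})$ is the set of $f\in\mathrm{dom}(S_\rho)$ with $f':=\mathbf{R}(S_\rho(f))\in\mathrm{dom}(S'_{\rho'})$, and $S''_{(\rho,\rho')}(f)=(S_\rho(f),S'_{\rho'}(f'))$. Given a category $\mathcal{C}$ with wide subcategories $\mathcal{M},\mathcal{D}$, $\mathcal{D}^{\to\mathcal{M}}$ has objects the morphisms of $\mathcal{D}$ and morphisms $(\rho:A\to B)\to(\rho_1:A_1\to B_1)$ the pairs $(a,b)$ of morphisms of $\mathcal{M}$ with $b\circ\rho=\rho_1\circ a$. The inverse arrows-based span is $\mathcal{M}\xleftarrow{\mathrm{Tgt}}\mathcal{D}^{\to\mathcal{M}}\xrightarrow{\mathrm{Src}}\mathcal{M}$ (a rule $L\rightsquigarrow K$ is a morphism $l:K\to L$ of $\mathcal{D}$). Graphs: nodes, edges, source and target functions; $\mathbf{Graph}$ the category of graphs, $\mathbf{Graph}^m$ its wide subcategory of injective morphisms. A final pullback complement of $l:K\to L$ and $f:L\to L_1$ is a pair $(g:K\to K_1, l_1:K_1\to L_1)$ with $l_1\circ g=f\circ l$ a pullback square such that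 for every pullback square $l'\circ g'=f\circ m$ ($m:K'\to L$, $g':K'\to K'_1$, $l':K'_1\to L_1$) and every $h:K'\to K$ with $l\circ h=m$ there is a unique $k:K'_1\to K_1$ with $l_1\circ k=l'$ and $k\circ g'=g\circ h$. A morphism $f:L\to L_1$ is conflict-free w.r.t. $l:K\to L$ if no items $x\in l(K)$, $y\notin l(K)$ of $L$ have $f(x)=f(y)$. $\mathcal{R}_{\mathrm{fpbc},1}$: inverse arrows-based span on $\mathbf{Graph}$ with rules in $\mathbf{Graph}^m$ and matches in $\mathbf{Graph}$; for rule $l:K\to L$, $\mathrm{dom}(S_l)$ = matches conflict-free w.r.t. $l$, and $S_l(f)=(f,g):l\to l_1$ given by the final pullback complement $(g,l_1)$ of $l$ and $f$ (known to exist, with $l_1$ injective). $\mathcal{R}_{\mathrm{fpbc},2}$: inverse arrows-based span on $\mathbf{Graph}$ with rules in $\mathbf{Graph}$ and matches in $\mathbf{Graph}^m$; $S_l$ total, $S_l(f)$ given by the final pullback complement (known to exist for injective $f$, with $g$ injective). $\mathcal{R}_{\mathrm{po},\mathbf{Graph}}$: $\mathcal{L}=\mathcal{R}=\mathbf{Graph}$, $\mathcal{P}=\mathbf{Graph}^{\to}$ (arrow category), source and target functors, $S_\rho$ total with $S_\rho(f)$ the pushout square of $\rho$ and $f$. $\mathcal{R}_{\mathrm{sqpo},i}$ is the composition of $\mathcal{R}_{\mathrm{fpbc},i}$ followed by $\mathcal{R}_{\mathrm{po},\mathbf{Graph}}$. -}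

module Defs where

open import Data.Product using (Σ; Σ-syntax; ∃; _×_; _,_; proj₁; proj₂)
open import Data.Unit using (⊤; tt)
open import Relation.Nullary using (¬_)
open import Relation.Binary.PropositionalEquality
  using (_≡_; refl; sym; trans; cong)
open import Function.Definitions using (Injective)

record Graph : Set₁ where
  field
    Node : Set
    Edge : Set
    src  : Edge → Node
    tgt  : Edge → Node
open Graph public

record _⇒_ (G H : Graph) : Set where
  field
    nmap : Node G → Node H
    emap : Edge G → Edge H
    src-comm : ∀ e → src H (emap e) ≡ nmap (src G e)
    tgt-comm : ∀ e → tgt H (emap e) ≡ nmap (tgt G e)
open _⇒_ public

infixr 9 _∘G_
infix 4 _≈G_

idG : ∀ {G} → G ⇒ G
idG = record { nmap = λ x → x ; emap = λ e → e
             ; src-comm = λ _ → refl ; tgt-comm = λ _ → refl }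

_∘G_ : ∀ {A B C} → B ⇒ C → A ⇒ B → A ⇒ C
g ∘G f = record
  { nmap = λ x → nmap g (nmap f x)
  ; emap = λ e → emap g (emap f e)
  ; src-comm = λ e → trans (src-comm g (emap f e)) (cong (nmap g) (src-comm f e))
  ; tgt-comm = λ e → trans (tgt-comm g (emap f e)) (cong (nmap g) (tgt-comm f e))
  }

record _≈G_ {G H : Graph} (f g : G ⇒ H) : Set where
  constructor _,_
  field
    n≈ : ∀ x → nmap f x ≡ nmap g x
    e≈ : ∀ e → emap f e ≡ emap g e
open _≈G_ public

≈G-refl : ∀ {G H} {f : G ⇒ H} → f ≈G f
≈G-refl = (λ _ → refl) , (λ _ → refl)

≈G-sym : ∀ {G H} {f g : G ⇒ H} → f ≈G g → g ≈G f
≈G-sym (p , q) = (λ x → sym (p x)) , (λ e → sym (q e))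

≈G-trans : ∀ {G H} {f g h : G ⇒ H} → f ≈G g → g ≈G h → f ≈G h
≈G-trans (p , q) (p' , q') = (λ x → trans (p x) (p' x)) , (λ e → trans (q e) (q' e))

∘G-cong : ∀ {A B C} {g g' : B ⇒ C} {f f' : A ⇒ B} → g ≈G g' → f ≈G f' → g ∘G f ≈G g' ∘G f'
∘G-cong {g = g} {g'} (p , q) (p' , q') =
  (λ x → trans (cong (nmap g) (p' _)) (p _)) , (λ e → trans (cong (emap g) (q' _)) (q _))

InjectiveG : ∀ {G H} → G ⇒ H → Set
InjectiveG {G} {H} f = Injective _≡_ _≡_ (nmap f) × Injective _≡_ _≡_ (emap f)

record WideSub : Set₁ where
  field
    Mor    : ∀ {G H} → G ⇒ H → Set
    Mor-id : ∀ {G} → Mor (idG {G})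
    Mor-∘  : ∀ {A B C} {g : B ⇒ C} {f : A ⇒ B} → Mor g → Mor f → Mor (g ∘G f)
open WideSub public

AllG : WideSub
AllG = record { Mor = λ _ → ⊤ ; Mor-id = tt ; Mor-∘ = λ _ _ → tt }

InjG : WideSub
InjG = record
  { Mor = InjectiveG
  ; Mor-id = (λ p → p) , (λ p → p)
  ; Mor-∘ = λ { {g = g} {f} (gn , ge) (fn , fe) → (λ p → fn (gn p)) , (λ p → fe (ge p)) }
  }

IsPullback : ∀ {A B C P} (f : A ⇒ C) (g : B ⇒ C) (p : P ⇒ A) (q : P ⇒ B) → Set₁
IsPullback {A} {B} {C} {P} f g p q =
  (f ∘G p ≈G g ∘G q) ×
  (∀ {X} (x : X ⇒ A) (y : X ⇒ B) → f ∘G x ≈G g ∘G y →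
     Σ[ u ∈ X ⇒ P ] ((p ∘G u ≈G x) × (q ∘G u ≈G y)) ×
       (∀ (u' : X ⇒ P) → p ∘G u' ≈G x → q ∘G u' ≈G y → u' ≈G u))

IsPushout : ∀ {A B C P} (f : A ⇒ B) (g : A ⇒ C) (p : B ⇒ P) (q : C ⇒ P) → Set₁
IsPushout {A} {B} {C} {P} f g p q =
  (p ∘G f ≈G q ∘G g) ×
  (∀ {X} (x : B ⇒ X) (y : C ⇒ X) → x ∘G f ≈G y ∘G g →
     Σ[ u ∈ P ⇒ X ] ((u ∘G p ≈G x) × (u ∘G q ≈G y)) ×
       (∀ (u' : P ⇒ X) → u' ∘G p ≈G x → u' ∘G q ≈G y → u' ≈G u))

IsFPBC : ∀ {K L L₁ K₁} (l : K ⇒ L) (f : L ⇒ L₁) (g : K ⇒ K₁) (l₁ : K₁ ⇒ L₁) → Set₁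
IsFPBC {K} {L} {L₁} {K₁} l f g l₁ =
  IsPullback f l₁ l g ×
  (∀ {K' K₁'} (m : K' ⇒ L) (g' : K' ⇒ K₁') (l' : K₁' ⇒ L₁) →
     IsPullback f l' m g' →
     (h : K' ⇒ K) → l ∘G h ≈G m →
     Σ[ k ∈ K₁' ⇒ K₁ ] ((l₁ ∘G k ≈G l') × (k ∘G g' ≈G g ∘G h)) ×
       (∀ (k' : K₁' ⇒ K₁) → l₁ ∘G k' ≈G l' → k' ∘G g' ≈G g ∘G h → k' ≈G k))

ConflictFree : ∀ {K L L₁} (l : K ⇒ L) (f : L ⇒ L₁) → Set
ConflictFree {K} {L} l f =
  (¬ (Σ[ x ∈ Node L ] Σ[ y ∈ Node L ]
       (∃ λ k → nmap l k ≡ x) × (¬ (∃ λ k → nmap l k ≡ y)) × (nmap f x ≡ nmap f y))) ×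
  (¬ (Σ[ x ∈ Edge L ] Σ[ y ∈ Edge L ]
       (∃ λ k → emap l k ≡ x) × (¬ (∃ λ k → emap l k ≡ y)) × (emap f x ≡ emap f y)))

-- Categorical rewriting systems whose left category is (a wide
-- subcategory of) Graph, presented in "displayed" form:
--   Rule L      = objects ρ of P with 𝐋(ρ) = L
--   Hom ρ ρ₁ f  = morphisms π : ρ → ρ₁ of P with 𝐋(π) = f
--   Rhs, rmap   = the functor 𝐑 : P → Graph
--   S ρ ρ₁ f π  = "π is (a representative of) S_ρ(f)"  (S is defined up to
--                 isomorphism, so it is given as a relation; f ∈ dom(S_ρ)
--                 iff some π is related)

record CRS : Set₂ where
  infix 4 _≈P_
  infixr 9 _∘P_
  field
    Rule : Graph → Set₁
    Hom  : ∀ {A B} → Rule A → Rule B → A ⇒ B → Set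
    -- equality of morphisms of P (compares all components, incl. 𝐋-image)
    _≈P_ : ∀ {A B} {ρ : Rule A} {ρ₁ : Rule B} {f f' : A ⇒ B} →
           Hom ρ ρ₁ f → Hom ρ ρ₁ f' → Set
    idP  : ∀ {A} {ρ : Rule A} → Hom ρ ρ idG
    _∘P_ : ∀ {A B C} {ρ : Rule A} {ρ₁ : Rule B} {ρ₂ : Rule C}
             {f₁ : A ⇒ B} {f₂ : B ⇒ C} →
           Hom ρ₁ ρ₂ f₂ → Hom ρ ρ₁ f₁ → Hom ρ ρ₂ (f₂ ∘G f₁)
    Rhs  : ∀ {A} → Rule A → Graph
    rmap : ∀ {A B} {ρ : Rule A} {ρ₁ : Rule B} {f : A ⇒ B} →
           Hom ρ ρ₁ f → Rhs ρ ⇒ Rhs ρ₁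
    rmap-id : ∀ {A} {ρ : Rule A} → rmap (idP {ρ = ρ}) ≈G idG
    rmap-∘  : ∀ {A B C} {ρ : Rule A} {ρ₁ : Rule B} {ρ₂ : Rule C}
                {f₁ : A ⇒ B} {f₂ : B ⇒ C}
                (π₂ : Hom ρ₁ ρ₂ f₂) (π₁ : Hom ρ ρ₁ f₁) →
              rmap (π₂ ∘P π₁) ≈G rmap π₂ ∘G rmap π₁
    S    : ∀ {A B} (ρ : Rule A) (ρ₁ : Rule B) (f : A ⇒ B) → Hom ρ ρ₁ f → Set₁

module _ (𝓡 : CRS) where
  open CRS 𝓡

  InDom : ∀ {A B} (ρ : Rule A) (f : A ⇒ B) → Set₁
  InDom {A} {B} ρ f = Σ[ ρ₁ ∈ Rule B ] Σ[ π ∈ Hom ρ ρ₁ f ] S ρ ρ₁ f π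

  UpToIso : ∀ {A B} {ρ : Rule A} {ρ₁ ρ₂ : Rule B} {f : A ⇒ B} →
            Hom ρ ρ₁ f → Hom ρ ρ₂ f → Set
  UpToIso {ρ₁ = ρ₁} {ρ₂} π π' =
    Σ[ φ ∈ Hom ρ₁ ρ₂ idG ] Σ[ ψ ∈ Hom ρ₂ ρ₁ idG ]
      (φ ∘P ψ ≈P idP) × (ψ ∘P φ ≈P idP) × (φ ∘P π ≈P π')

  FunctorialI : Set₁
  FunctorialI = ∀ {L} (ρ : Rule L) →
       InDom ρ idG ×
       (∀ (ρ₁ : Rule L) (π : Hom ρ ρ₁ idG) → S ρ ρ₁ idG π → UpToIso π idP)

  FunctorialII : Set₁
  FunctorialII = ∀ {L L₁ L₂} (ρ : Rule L) (ρ₁ : Rule L₁) (ρ₂ : Rule L₂)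
       (f₁ : L ⇒ L₁) (f₂ : L₁ ⇒ L₂)
       (π₁ : Hom ρ ρ₁ f₁) (π₂ : Hom ρ₁ ρ₂ f₂) →
       S ρ ρ₁ f₁ π₁ → S ρ₁ ρ₂ f₂ π₂ →
       InDom ρ (f₂ ∘G f₁) ×
       (∀ (ρ₃ : Rule L₂) (π₃ : Hom ρ ρ₃ (f₂ ∘G f₁)) → S ρ ρ₃ (f₂ ∘G f₁) π₃ →
          UpToIso (π₂ ∘P π₁) π₃)

  Functorial : Set₁
  Functorial = FunctorialI × FunctorialII

-- Composition of rewriting systems: pullback of 𝐑 and 𝐋'
-- (morphisms are pairs (π , π') with 𝐑(π) = 𝐋'(π'), equality of graph
-- morphisms being ≈G)

record CompRule (𝓡 𝓡' : CRS) (A : Graph) : Set₁ where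
  field
    fst : CRS.Rule 𝓡 A
    snd : CRS.Rule 𝓡' (CRS.Rhs 𝓡 fst)

record CompHom (𝓡 𝓡' : CRS) {A B : Graph} (ρ : CompRule 𝓡 𝓡' A) (ρ₁ : CompRule 𝓡 𝓡' B)
               (f : A ⇒ B) : Set where
  field
    hfst  : CRS.Hom 𝓡 (CompRule.fst ρ) (CompRule.fst ρ₁) f
    f'    : CRS.Rhs 𝓡 (CompRule.fst ρ) ⇒ CRS.Rhs 𝓡 (CompRule.fst ρ₁)
    f'≈   : f' ≈G CRS.rmap 𝓡 hfst
    hsnd  : CRS.Hom 𝓡' (CompRule.snd ρ) (CompRule.snd ρ₁) f'

_⨾_ : CRS → CRS → CRS
𝓡 ⨾ 𝓡' = record
  { Rule = CompRule 𝓡 𝓡'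
  ; Hom  = CompHom 𝓡 𝓡'
  ; _≈P_ = λ π σ → (CRS._≈P_ 𝓡 (CompHom.hfst π) (CompHom.hfst σ)) ×
                   (CRS._≈P_ 𝓡' (CompHom.hsnd π) (CompHom.hsnd σ))
  ; idP  = record { hfst = CRS.idP 𝓡 ; f' = idG
                  ; f'≈ = ≈G-sym (CRS.rmap-id 𝓡) ; hsnd = CRS.idP 𝓡' }
  ; _∘P_ = λ π₂ π₁ → record
      { hfst = CRS._∘P_ 𝓡 (CompHom.hfst π₂) (CompHom.hfst π₁)
      ; f'   = CompHom.f' π₂ ∘G CompHom.f' π₁
      ; f'≈  = ≈G-trans (∘G-cong (CompHom.f'≈ π₂) (CompHom.f'≈ π₁))
                        (≈G-sym (CRS.rmap-∘ 𝓡 (CompHom.hfst π₂) (CompHom.hfst π₁)))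
      ; hsnd = CRS._∘P_ 𝓡' (CompHom.hsnd π₂) (CompHom.hsnd π₁) }
  ; Rhs  = λ ρ → CRS.Rhs 𝓡' (CompRule.snd ρ)
  ; rmap = λ π → CRS.rmap 𝓡' (CompHom.hsnd π)
  ; rmap-id = CRS.rmap-id 𝓡'
  ; rmap-∘  = λ π₂ π₁ → CRS.rmap-∘ 𝓡' (CompHom.hsnd π₂) (CompHom.hsnd π₁)
  -- f ∈ dom(S''_(ρ,ρ')) iff f ∈ dom(S_ρ) and 𝐑(S_ρ(f)) ∈ dom(S'_ρ');
  -- S''(f) = (S_ρ(f) , S'_ρ'(𝐑(S_ρ(f))))
  ; S    = λ ρ ρ₁ f π →
      CRS.S 𝓡 (CompRule.fst ρ) (CompRule.fst ρ₁) f (CompHom.hfst π) ×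
      CRS.S 𝓡' (CompRule.snd ρ) (CompRule.snd ρ₁) (CompHom.f' π) (CompHom.hsnd π)
  }

-- Inverse arrows-based span  M ←Tgt− D^{→M} −Src→ M  on Graph.
-- A rule L ⇝ K is a morphism l : K → L of D; a morphism l → l₁ over the
-- match f (= its Tgt-component) is (a , f) with a, f in M and f ∘ l = l₁ ∘ a.

record ARule (D : WideSub) (L : Graph) : Set₁ where
  field
    K   : Graph
    l   : K ⇒ L
    l∈D : Mor D l
open ARule public

record AHom (D M : WideSub) {L L₁ : Graph} (ρ : ARule D L) (ρ₁ : ARule D L₁)
            (f : L ⇒ L₁) : Set where
  field
    a    : K ρ ⇒ K ρ₁
    a∈M  : Mor M a
    f∈M  : Mor M f
    comm : f ∘G l ρ ≈G l ρ₁ ∘G a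
open AHom public

fpbcSystem : (D M : WideSub) →
             (Dom : ∀ {K L L₁} → K ⇒ L → L ⇒ L₁ → Set) → CRS
fpbcSystem D M Dom = record
  { Rule = ARule D
  ; Hom  = AHom D M
  ; _≈P_ = λ {f = f} {f'} π σ → (f ≈G f') × (a π ≈G a σ)
  ; idP  = record { a = idG ; a∈M = Mor-id M ; f∈M = Mor-id M ; comm = (λ _ → refl) , (λ _ → refl) }
  ; _∘P_ = λ {ρ = ρ} {ρ₁} {ρ₂} {f₁} {f₂} π₂ π₁ → record
      { a = a π₂ ∘G a π₁
      ; a∈M = Mor-∘ M (a∈M π₂) (a∈M π₁)
      ; f∈M = Mor-∘ M (f∈M π₂) (f∈M π₁)
      ; comm = (λ x → trans (cong (nmap f₂) (n≈ (comm π₁) x)) (n≈ (comm π₂) (nmap (a π₁) x)))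
             , (λ e → trans (cong (emap f₂) (e≈ (comm π₁) e)) (e≈ (comm π₂) (emap (a π₁) e)))
      }
  ; Rhs  = K
  ; rmap = a
  ; rmap-id = ≈G-refl
  ; rmap-∘  = λ _ _ → (λ _ → refl) , (λ _ → refl)
  ; S    = λ ρ ρ₁ f π → (Dom (l ρ) f) × IsFPBC (l ρ) f (a π) (l ρ₁)
  }

𝓡fpbc₁ : CRS
𝓡fpbc₁ = fpbcSystem InjG AllG ConflictFree

𝓡fpbc₂ : CRS
𝓡fpbc₂ = fpbcSystem AllG InjG (λ _ _ → ⊤)

-- 𝓡_po,Graph : Graph ←Src− Graph^→ −Tgt→ Graph, S_ρ(f) = pushout square

record PRule (A : Graph) : Set₁ where
  field
    B : Graph
    r : A ⇒ B
open PRule public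

record PHom {A A₁ : Graph} (ρ : PRule A) (ρ₁ : PRule A₁) (f : A ⇒ A₁) : Set where
  field
    h     : B ρ ⇒ B ρ₁
    pcomm : h ∘G r ρ ≈G r ρ₁ ∘G f
open PHom public

𝓡po : CRS
𝓡po = record
  { Rule = PRule
  ; Hom  = PHom
  ; _≈P_ = λ {f = f} {f'} π σ → (f ≈G f') × (h π ≈G h σ)
  ; idP  = record { h = idG ; pcomm = (λ _ → refl) , (λ _ → refl) }
  ; _∘P_ = λ {ρ = ρ} {ρ₁} {ρ₂} {f₁} {f₂} π₂ π₁ → record
      { h = h π₂ ∘G h π₁
      ; pcomm = (λ x → trans (cong (nmap (h π₂)) (n≈ (pcomm π₁) x)) (n≈ (pcomm π₂) (nmap f₁ x)))
              , (λ e → trans (cong (emap (h π₂)) (e≈ (pcomm π₁) e)) (e≈ (pcomm π₂) (emap f₁ e)))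
      }
  ; Rhs  = B
  ; rmap = h
  ; rmap-id = ≈G-refl
  ; rmap-∘  = λ _ _ → (λ _ → refl) , (λ _ → refl)
  ; S    = λ ρ ρ₁ f π → IsPushout (r ρ) f (h π) (r ρ₁)
  }

𝓡sqpo₁ : CRS
𝓡sqpo₁ = 𝓡fpbc₁ ⨾ 𝓡po

𝓡sqpo₂ : CRS
𝓡sqpo₂ = 𝓡fpbc₂ ⨾ 𝓡po

-- Both systems are built from final pullback complements, and the sesqui-pushout
-- systems additionally from pushouts. Each of these universal constructions is
-- unique up to isomorphism, contains the identity square, and is closed
-- under horizontal pasting. Functoriality (i) is then uniqueness applied to the
-- identity square, and (ii) is uniqueness applied to the pasted square; the
-- domain conditions pass along pasting because conflict-freeness is reflected
-- along pullback squares, and isomorphisms are matches in both settings.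
module Submission where

open import Axiom.UniquenessOfIdentityProofs.WithK using (uip)
open import Data.Empty using (⊥)
open import Data.Product using (_×_; _,_; proj₁; proj₂; Σ-syntax; ∃)
open import Data.Unit using (⊤; tt)
open import Relation.Binary.PropositionalEquality using (_≡_; refl; sym; trans; cong)

open import Defs

-- Equality of graph morphisms indexed by the underlying maps only, so that the
-- associativity and unit laws of ∘G hold definitionally at this type.
record PointwiseEq {N₁ N₂ E₁ E₂ : Set} (fn gn : N₁ → N₂) (fe ge : E₁ → E₂) : Set where
  constructor pointwise
  field
    on-nodes : ∀ x → fn x ≡ gn x
    on-edges : ∀ e → fe e ≡ ge e
open PointwiseEq public

infix 4 _≃_
_≃_ : ∀ {G H} → G ⇒ H → G ⇒ H → Set
f ≃ g = PointwiseEq (nmap f) (nmap g) (emap f) (emap g)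

≃⇒≈G : ∀ {G H} {f g : G ⇒ H} → f ≃ g → f ≈G g
≃⇒≈G (pointwise p q) = p , q

≈G⇒≃ : ∀ {G H} {f g : G ⇒ H} → f ≈G g → f ≃ g
≈G⇒≃ (p , q) = pointwise p q

module _ {N₁ N₂ E₁ E₂ : Set} where

  ≃-refl : ∀ {fn : N₁ → N₂} {fe : E₁ → E₂} → PointwiseEq fn fn fe fe
  ≃-refl = pointwise (λ _ → refl) (λ _ → refl)

  ≃-sym : ∀ {fn gn : N₁ → N₂} {fe ge : E₁ → E₂} →
          PointwiseEq fn gn fe ge → PointwiseEq gn fn ge fe
  ≃-sym (pointwise p q) = pointwise (λ x → sym (p x)) (λ e → sym (q e))

  infixr 5 _∙_
  _∙_ : ∀ {fn gn hn : N₁ → N₂} {fe ge he : E₁ → E₂} →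
        PointwiseEq fn gn fe ge → PointwiseEq gn hn ge he → PointwiseEq fn hn fe he
  pointwise p q ∙ pointwise p' q' =
    pointwise (λ x → trans (p x) (p' x)) (λ e → trans (q e) (q' e))

infixl 6 _▹_
_▹_ : ∀ {A B} {N E : Set} {gn gn' : Node B → N} {ge ge' : Edge B → E} →
      PointwiseEq gn gn' ge ge' → (f : A ⇒ B) →
      PointwiseEq (λ x → gn (nmap f x)) (λ x → gn' (nmap f x))
                  (λ e → ge (emap f e)) (λ e → ge' (emap f e))
pointwise p q ▹ f = pointwise (λ x → p (nmap f x)) (λ e → q (emap f e))

infixr 6 _◃_
_◃_ : ∀ {N E : Set} {B C} (h : B ⇒ C) {fn fn' : N → Node B} {fe fe' : E → Edge B} →
      PointwiseEq fn fn' fe fe' →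
      PointwiseEq (λ x → nmap h (fn x)) (λ x → nmap h (fn' x))
                  (λ e → emap h (fe e)) (λ e → emap h (fe' e))
h ◃ pointwise p q = pointwise (λ x → cong (nmap h) (p x)) (λ e → cong (emap h) (q e))

infix 4 _≅_
record _≅_ (G H : Graph) : Set where
  field
    to      : G ⇒ H
    from    : H ⇒ G
    to∘from : to ∘G from ≃ idG
    from∘to : from ∘G to ≃ idG
open _≅_ public

≅-refl : ∀ {G} → G ≅ G
≅-refl = record { to = idG ; from = idG ; to∘from = ≃-refl ; from∘to = ≃-refl }

≅-sym : ∀ {G H} → G ≅ H → H ≅ G
≅-sym i = record { to = from i ; from = to i ; to∘from = from∘to i ; from∘to = to∘from i }

transpose-square : ∀ {A A' B B'} (i : A ≅ A') (j : B ≅ B') {u : A ⇒ B} {u' : A' ⇒ B'} →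
                   to j ∘G u ≃ u' ∘G to i → from j ∘G u' ≃ u ∘G from i
transpose-square i j {u} {u'} e =
  ≃-sym ((from j ∘G u') ◃ to∘from i) ∙ from j ◃ (≃-sym e ▹ from i) ∙ from∘to j ▹ (u ∘G from i)

to-injective : ∀ {G H} (i : G ≅ H) → InjectiveG (to i)
to-injective i =
    (λ {x} {y} p → trans (sym (on-nodes (from∘to i) x))
                         (trans (cong (nmap (from i)) p) (on-nodes (from∘to i) y)))
  , (λ {x} {y} p → trans (sym (on-edges (from∘to i) x))
                         (trans (cong (emap (from i)) p) (on-edges (from∘to i) y)))

record Pullback {A B C P : Graph} (f : A ⇒ C) (g : B ⇒ C) (p : P ⇒ A) (q : P ⇒ B) : Set₁ where
  field
    commute     : f ∘G p ≃ g ∘G q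
    universal   : ∀ {X} (x : X ⇒ A) (y : X ⇒ B) → f ∘G x ≃ g ∘G y → X ⇒ P
    p∘universal : ∀ {X} (x : X ⇒ A) (y : X ⇒ B) (c : f ∘G x ≃ g ∘G y) →
                  p ∘G universal x y c ≃ x
    q∘universal : ∀ {X} (x : X ⇒ A) (y : X ⇒ B) (c : f ∘G x ≃ g ∘G y) →
                  q ∘G universal x y c ≃ y
    unique      : ∀ {X} (x : X ⇒ A) (y : X ⇒ B) (c : f ∘G x ≃ g ∘G y) (u : X ⇒ P) →
                  p ∘G u ≃ x → q ∘G u ≃ y → u ≃ universal x y c

  jointly-monic : ∀ {X} (z z' : X ⇒ P) → p ∘G z ≃ p ∘G z' → q ∘G z ≃ q ∘G z' → z ≃ z'
  jointly-monic z z' e₁ e₂ =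
    unique (p ∘G z) (q ∘G z) (commute ▹ z) z ≃-refl ≃-refl
    ∙ ≃-sym (unique (p ∘G z) (q ∘G z) (commute ▹ z) z' (≃-sym e₁) (≃-sym e₂))

module PB = Pullback

module _ {A B C P : Graph} {f : A ⇒ C} {g : B ⇒ C} {p : P ⇒ A} {q : P ⇒ B} where

  IsPullback⇒Pullback : IsPullback f g p q → Pullback f g p q
  IsPullback⇒Pullback (c , univ) = record
    { commute     = ≈G⇒≃ c
    ; universal   = λ x y c → proj₁ (univ x y (≃⇒≈G c))
    ; p∘universal = λ x y c → ≈G⇒≃ (proj₁ (proj₁ (proj₂ (univ x y (≃⇒≈G c)))))
    ; q∘universal = λ x y c → ≈G⇒≃ (proj₂ (proj₁ (proj₂ (univ x y (≃⇒≈G c)))))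
    ; unique      = λ x y c u e₁ e₂ →
                      ≈G⇒≃ (proj₂ (proj₂ (univ x y (≃⇒≈G c))) u (≃⇒≈G e₁) (≃⇒≈G e₂))
    }

  Pullback⇒IsPullback : Pullback f g p q → IsPullback f g p q
  Pullback⇒IsPullback P =
      ≃⇒≈G (PB.commute P)
    , λ x y c → PB.universal P x y (≈G⇒≃ c)
              , (≃⇒≈G (PB.p∘universal P x y (≈G⇒≃ c)) , ≃⇒≈G (PB.q∘universal P x y (≈G⇒≃ c)))
              , λ u e₁ e₂ → ≃⇒≈G (PB.unique P x y (≈G⇒≃ c) u (≈G⇒≃ e₁) (≈G⇒≃ e₂))

FiberProduct : {A B C : Set} → (A → C) → (B → C) → Set
FiberProduct {A} {B} f g = Σ[ a ∈ A ] Σ[ b ∈ B ] f a ≡ g b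

fiberProduct-≡ : ∀ {A B C : Set} {f : A → C} {g : B → C} {a a' : A} {b b' : B}
                   {e : f a ≡ g b} {e' : f a' ≡ g b'} →
                 a ≡ a' → b ≡ b' → _≡_ {A = FiberProduct f g} (a , b , e) (a' , b' , e')
fiberProduct-≡ {e = e} {e'} refl refl with uip e e'
... | refl = refl

module PullbackOf {A B C : Graph} (f : A ⇒ C) (g : B ⇒ C) where

  Apex : Graph
  Apex = record
    { Node = FiberProduct (nmap f) (nmap g)
    ; Edge = FiberProduct (emap f) (emap g)
    ; src  = λ (a , b , e) → src A a , src B b
                           , trans (sym (src-comm f a)) (trans (cong (src C) e) (src-comm g b))
    ; tgt  = λ (a , b , e) → tgt A a , tgt B b
                           , trans (sym (tgt-comm f a)) (trans (cong (tgt C) e) (tgt-comm g b))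
    }

  p₁ : Apex ⇒ A
  p₁ = record { nmap = proj₁ ; emap = proj₁ ; src-comm = λ _ → refl ; tgt-comm = λ _ → refl }

  p₂ : Apex ⇒ B
  p₂ = record { nmap = λ t → proj₁ (proj₂ t) ; emap = λ t → proj₁ (proj₂ t)
              ; src-comm = λ _ → refl ; tgt-comm = λ _ → refl }

  pairing : ∀ {X} (x : X ⇒ A) (y : X ⇒ B) → f ∘G x ≃ g ∘G y → X ⇒ Apex
  pairing x y c = record
    { nmap     = λ z → nmap x z , nmap y z , on-nodes c z
    ; emap     = λ e → emap x e , emap y e , on-edges c e
    ; src-comm = λ e → fiberProduct-≡ (src-comm x e) (src-comm y e)
    ; tgt-comm = λ e → fiberProduct-≡ (tgt-comm x e) (tgt-comm y e)
    }

  pullback : Pullback f g p₁ p₂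
  pullback = record
    { commute     = pointwise (λ t → proj₂ (proj₂ t)) (λ t → proj₂ (proj₂ t))
    ; universal   = pairing
    ; p∘universal = λ _ _ _ → ≃-refl
    ; q∘universal = λ _ _ _ → ≃-refl
    ; unique      = λ _ _ _ _ e₁ e₂ →
        pointwise (λ z → fiberProduct-≡ (on-nodes e₁ z) (on-nodes e₂ z))
                  (λ e → fiberProduct-≡ (on-edges e₁ e) (on-edges e₂ e))
    }

pullback-glue : ∀ {K L L₁ L₂ K₁ K₂} {l : K ⇒ L} {f₁ : L ⇒ L₁} {a₁ : K ⇒ K₁} {l₁ : K₁ ⇒ L₁}
                  {f₂ : L₁ ⇒ L₂} {a₂ : K₁ ⇒ K₂} {l₂ : K₂ ⇒ L₂} →
                Pullback f₁ l₁ l a₁ → Pullback f₂ l₂ l₁ a₂ →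
                Pullback (f₂ ∘G f₁) l₂ l (a₂ ∘G a₁)
pullback-glue {L = L} {K₁ = K₁} {K₂} {f₁ = f₁} {a₁} {l₁} {f₂} {a₂} {l₂} pb₁ pb₂ = record
  { commute     = f₂ ◃ PB.commute pb₁ ∙ PB.commute pb₂ ▹ a₁
  ; universal   = λ x y c → PB.universal pb₁ x (right x y c) (right-p x y c)
  ; p∘universal = λ x y c → PB.p∘universal pb₁ x (right x y c) (right-p x y c)
  ; q∘universal = λ x y c → a₂ ◃ PB.q∘universal pb₁ x (right x y c) (right-p x y c)
                            ∙ PB.q∘universal pb₂ (f₁ ∘G x) y c
  ; unique      = λ x y c u lu au →
      PB.unique pb₁ x (right x y c) (right-p x y c) u lu
        (PB.unique pb₂ (f₁ ∘G x) y c (a₁ ∘G u) (≃-sym (PB.commute pb₁ ▹ u) ∙ f₁ ◃ lu) au)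
  }
  where
  module _ {X} (x : X ⇒ L) (y : X ⇒ K₂) (c : f₂ ∘G f₁ ∘G x ≃ l₂ ∘G y) where
    right : X ⇒ K₁
    right = PB.universal pb₂ (f₁ ∘G x) y c

    right-p : f₁ ∘G x ≃ l₁ ∘G right
    right-p = ≃-sym (PB.p∘universal pb₂ (f₁ ∘G x) y c)

pullback-unglue : ∀ {K' L L₁ L₂ K₁' P} {m : K' ⇒ L} {f₁ : L ⇒ L₁} {f₂ : L₁ ⇒ L₂}
                    {g' : K' ⇒ K₁'} {l' : K₁' ⇒ L₂} {p : P ⇒ L₁} {q : P ⇒ K₁'} →
                  Pullback (f₂ ∘G f₁) l' m g' → Pullback f₂ l' p q →
                  (v : K' ⇒ P) → p ∘G v ≃ f₁ ∘G m → q ∘G v ≃ g' →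
                  Pullback f₁ p m v
pullback-unglue {K'} {L} {P = P} {f₁ = f₁} {f₂} {l' = l'} {p} {q} outer right v pv qv = record
  { commute     = ≃-sym pv
  ; universal   = outer-universal
  ; p∘universal = λ x y c → PB.p∘universal outer x (q ∘G y) (extend x y c)
  ; q∘universal = λ x y c →
      PB.jointly-monic right (v ∘G outer-universal x y c) y
        (pv ▹ outer-universal x y c ∙ f₁ ◃ PB.p∘universal outer x (q ∘G y) (extend x y c) ∙ c)
        (qv ▹ outer-universal x y c ∙ PB.q∘universal outer x (q ∘G y) (extend x y c))
  ; unique      = λ x y c u mu vu →
      PB.unique outer x (q ∘G y) (extend x y c) u mu (≃-sym (qv ▹ u) ∙ q ◃ vu)
  }
  where
  module _ {X} (x : X ⇒ L) (y : X ⇒ P) (c : f₁ ∘G x ≃ p ∘G y) where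
    extend : f₂ ∘G f₁ ∘G x ≃ l' ∘G q ∘G y
    extend = f₂ ◃ c ∙ PB.commute right ▹ y

    outer-universal : X ⇒ K'
    outer-universal = PB.universal outer x (q ∘G y) extend

record FinalPullbackComplement {K L L₁ K₁ : Graph}
         (l : K ⇒ L) (f : L ⇒ L₁) (g : K ⇒ K₁) (l₁ : K₁ ⇒ L₁) : Set₁ where
  field
    pullback     : Pullback f l₁ l g
    universal    : ∀ {K' K₁'} {m : K' ⇒ L} {g' : K' ⇒ K₁'} {l' : K₁' ⇒ L₁} →
                   Pullback f l' m g' → (h : K' ⇒ K) → l ∘G h ≃ m → K₁' ⇒ K₁
    l₁∘universal : ∀ {K' K₁'} {m : K' ⇒ L} {g' : K' ⇒ K₁'} {l' : K₁' ⇒ L₁}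
                   (pb : Pullback f l' m g') (h : K' ⇒ K) (e : l ∘G h ≃ m) →
                   l₁ ∘G universal pb h e ≃ l'
    universal∘g' : ∀ {K' K₁'} {m : K' ⇒ L} {g' : K' ⇒ K₁'} {l' : K₁' ⇒ L₁}
                   (pb : Pullback f l' m g') (h : K' ⇒ K) (e : l ∘G h ≃ m) →
                   universal pb h e ∘G g' ≃ g ∘G h
    unique       : ∀ {K' K₁'} {m : K' ⇒ L} {g' : K' ⇒ K₁'} {l' : K₁' ⇒ L₁}
                   (pb : Pullback f l' m g') (h : K' ⇒ K) (e : l ∘G h ≃ m) (k : K₁' ⇒ K₁) →
                   l₁ ∘G k ≃ l' → k ∘G g' ≃ g ∘G h → k ≃ universal pb h e

  rigid : (k : K₁ ⇒ K₁) → l₁ ∘G k ≃ l₁ → k ∘G g ≃ g → k ≃ idG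
  rigid k e₁ e₂ = unique pullback idG ≃-refl k e₁ e₂
                  ∙ ≃-sym (unique pullback idG ≃-refl idG ≃-refl ≃-refl)

module FPBC = FinalPullbackComplement

module _ {K L L₁ K₁ : Graph} {l : K ⇒ L} {f : L ⇒ L₁} {g : K ⇒ K₁} {l₁ : K₁ ⇒ L₁} where

  IsFPBC⇒FinalPullbackComplement : IsFPBC l f g l₁ → FinalPullbackComplement l f g l₁
  IsFPBC⇒FinalPullbackComplement (pb , fin) = record
    { pullback     = IsPullback⇒Pullback pb
    ; universal    = λ pb' h e → proj₁ (final pb' h e)
    ; l₁∘universal = λ pb' h e → ≈G⇒≃ (proj₁ (proj₁ (proj₂ (final pb' h e))))
    ; universal∘g' = λ pb' h e → ≈G⇒≃ (proj₂ (proj₁ (proj₂ (final pb' h e))))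
    ; unique       = λ pb' h e k e₁ e₂ →
                       ≈G⇒≃ (proj₂ (proj₂ (final pb' h e)) k (≃⇒≈G e₁) (≃⇒≈G e₂))
    }
    where
    final : ∀ {K' K₁'} {m : K' ⇒ L} {g' : K' ⇒ K₁'} {l' : K₁' ⇒ L₁}
            (pb' : Pullback f l' m g') (h : K' ⇒ K) (e : l ∘G h ≃ m) →
            Σ[ k ∈ K₁' ⇒ K₁ ] ((l₁ ∘G k ≈G l') × (k ∘G g' ≈G g ∘G h)) ×
              (∀ (k' : K₁' ⇒ K₁) → l₁ ∘G k' ≈G l' → k' ∘G g' ≈G g ∘G h → k' ≈G k)
    final {m = m} {g'} {l'} pb' h e = fin m g' l' (Pullback⇒IsPullback pb') h (≃⇒≈G e)

  FinalPullbackComplement⇒IsFPBC : FinalPullbackComplement l f g l₁ → IsFPBC l f g l₁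
  FinalPullbackComplement⇒IsFPBC F =
      Pullback⇒IsPullback (FPBC.pullback F)
    , λ m g' l' pb' h e →
        let pb = IsPullback⇒Pullback {f = f} {l'} {m} {g'} pb' in
          FPBC.universal F pb h (≈G⇒≃ e)
        , (≃⇒≈G (FPBC.l₁∘universal F pb h (≈G⇒≃ e)) , ≃⇒≈G (FPBC.universal∘g' F pb h (≈G⇒≃ e)))
        , λ k e₁ e₂ → ≃⇒≈G (FPBC.unique F pb h (≈G⇒≃ e) k (≈G⇒≃ e₁) (≈G⇒≃ e₂))

fpbc-id : ∀ {K L} (l : K ⇒ L) → FinalPullbackComplement l idG idG l
fpbc-id {L = L} l = record
  { pullback     = record
      { commute     = ≃-refl
      ; universal   = λ _ y _ → y
      ; p∘universal = λ _ _ c → ≃-sym c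
      ; q∘universal = λ _ _ _ → ≃-refl
      ; unique      = λ _ _ _ _ _ e₂ → e₂
      }
  ; universal    = λ pb h _ → h ∘G section pb
  ; l₁∘universal = λ pb h e → e ▹ section pb ∙ PB.p∘universal pb _ idG ≃-refl
  ; universal∘g' = λ pb h _ → h ◃ section-retraction pb
  ; unique       = λ pb h _ k _ kg → ≃-sym (k ◃ PB.q∘universal pb _ idG ≃-refl) ∙ kg ▹ section pb
  }
  where
  module _ {K' K₁'} {m : K' ⇒ L} {g' : K' ⇒ K₁'} {l' : K₁' ⇒ L} (pb : Pullback idG l' m g') where
    -- Pulling back along the identity, g' is an isomorphism with this inverse.
    section : K₁' ⇒ K'
    section = PB.universal pb l' idG ≃-refl

    section-retraction : section ∘G g' ≃ idG
    section-retraction =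
      PB.jointly-monic pb (section ∘G g') idG
        (PB.p∘universal pb l' idG ≃-refl ▹ g' ∙ ≃-sym (PB.commute pb))
        (PB.q∘universal pb l' idG ≃-refl ▹ g')

fpbc-glue : ∀ {K L L₁ L₂ K₁ K₂} {l : K ⇒ L} {f₁ : L ⇒ L₁} {a₁ : K ⇒ K₁} {l₁ : K₁ ⇒ L₁}
              {f₂ : L₁ ⇒ L₂} {a₂ : K₁ ⇒ K₂} {l₂ : K₂ ⇒ L₂} →
            FinalPullbackComplement l f₁ a₁ l₁ → FinalPullbackComplement l₁ f₂ a₂ l₂ →
            FinalPullbackComplement l (f₂ ∘G f₁) (a₂ ∘G a₁) l₂
fpbc-glue {K} {L} {L₂ = L₂} {K₁} {K₂} {l} {f₁} {a₁} {l₁} {f₂} {a₂} {l₂} F₁ F₂ = record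
  { pullback     = pullback-glue (FPBC.pullback F₁) (FPBC.pullback F₂)
  ; universal    = k
  ; l₁∘universal = l₂k
  ; universal∘g' = kg'
  ; unique       = unique
  }
  where
  -- The outer square is split along the pullback P of f₂ and l'; the left half
  -- is then a pullback, so the factorisation goes through F₁ and then F₂.
  module _ {K' K₁'} {m : K' ⇒ L} {g' : K' ⇒ K₁'} {l' : K₁' ⇒ L₂}
           (pb : Pullback (f₂ ∘G f₁) l' m g') where
    module P = PullbackOf f₂ l'

    v : K' ⇒ P.Apex
    v = PB.universal P.pullback (f₁ ∘G m) g' (PB.commute pb)

    p₁v : P.p₁ ∘G v ≃ f₁ ∘G m
    p₁v = PB.p∘universal P.pullback (f₁ ∘G m) g' (PB.commute pb)

    p₂v : P.p₂ ∘G v ≃ g'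
    p₂v = PB.q∘universal P.pullback (f₁ ∘G m) g' (PB.commute pb)

    left : Pullback f₁ P.p₁ m v
    left = pullback-unglue pb P.pullback v p₁v p₂v

    module _ (h : K' ⇒ K) (e : l ∘G h ≃ m) where
      k₁ : P.Apex ⇒ K₁
      k₁ = FPBC.universal F₁ left h e

      l₁k₁ : l₁ ∘G k₁ ≃ P.p₁
      l₁k₁ = FPBC.l₁∘universal F₁ left h e

      k : K₁' ⇒ K₂
      k = FPBC.universal F₂ P.pullback k₁ l₁k₁

      l₂k : l₂ ∘G k ≃ l'
      l₂k = FPBC.l₁∘universal F₂ P.pullback k₁ l₁k₁

      kp₂ : k ∘G P.p₂ ≃ a₂ ∘G k₁
      kp₂ = FPBC.universal∘g' F₂ P.pullback k₁ l₁k₁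

      kg' : k ∘G g' ≃ a₂ ∘G a₁ ∘G h
      kg' = ≃-sym (k ◃ p₂v) ∙ kp₂ ▹ v ∙ a₂ ◃ FPBC.universal∘g' F₁ left h e

      unique : (k' : K₁' ⇒ K₂) → l₂ ∘G k' ≃ l' → k' ∘G g' ≃ a₂ ∘G a₁ ∘G h → k' ≃ k
      unique k' l₂k' k'g' = FPBC.unique F₂ P.pullback k₁ l₁k₁ k' l₂k' (≃-sym a₂k'' ∙ a₂ ◃ k''≃k₁)
        where
        c : f₂ ∘G P.p₁ ≃ l₂ ∘G k' ∘G P.p₂
        c = PB.commute P.pullback ∙ ≃-sym (l₂k' ▹ P.p₂)

        k'' : P.Apex ⇒ K₁
        k'' = PB.universal (FPBC.pullback F₂) P.p₁ (k' ∘G P.p₂) c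

        l₁k'' : l₁ ∘G k'' ≃ P.p₁
        l₁k'' = PB.p∘universal (FPBC.pullback F₂) P.p₁ (k' ∘G P.p₂) c

        a₂k'' : a₂ ∘G k'' ≃ k' ∘G P.p₂
        a₂k'' = PB.q∘universal (FPBC.pullback F₂) P.p₁ (k' ∘G P.p₂) c

        k''v : k'' ∘G v ≃ a₁ ∘G h
        k''v = PB.jointly-monic (FPBC.pullback F₂) (k'' ∘G v) (a₁ ∘G h)
                 (l₁k'' ▹ v ∙ p₁v ∙ ≃-sym (f₁ ◃ e) ∙ PB.commute (FPBC.pullback F₁) ▹ h)
                 (a₂k'' ▹ v ∙ k' ◃ p₂v ∙ k'g')

        k''≃k₁ : k'' ≃ k₁
        k''≃k₁ = FPBC.unique F₁ left h e k'' l₁k'' k''v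

fpbc-unique : ∀ {K L L₁ K₁ K₂} {l : K ⇒ L} {f : L ⇒ L₁} {a₁ : K ⇒ K₁} {l₁ : K₁ ⇒ L₁}
                {a₂ : K ⇒ K₂} {l₂ : K₂ ⇒ L₁} →
              FinalPullbackComplement l f a₁ l₁ → FinalPullbackComplement l f a₂ l₂ →
              Σ[ i ∈ K₁ ≅ K₂ ] (l₁ ≃ l₂ ∘G to i) × (to i ∘G a₁ ≃ a₂)
fpbc-unique {K₁ = K₁} {K₂} {a₁ = a₁} {l₁} {a₂} {l₂} F₁ F₂ = i , ≃-sym l₂α , αa₁
  where
  α : K₁ ⇒ K₂
  α = FPBC.universal F₂ (FPBC.pullback F₁) idG ≃-refl
  l₂α : l₂ ∘G α ≃ l₁
  l₂α = FPBC.l₁∘universal F₂ (FPBC.pullback F₁) idG ≃-refl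
  αa₁ : α ∘G a₁ ≃ a₂
  αa₁ = FPBC.universal∘g' F₂ (FPBC.pullback F₁) idG ≃-refl
  β : K₂ ⇒ K₁
  β = FPBC.universal F₁ (FPBC.pullback F₂) idG ≃-refl
  l₁β : l₁ ∘G β ≃ l₂
  l₁β = FPBC.l₁∘universal F₁ (FPBC.pullback F₂) idG ≃-refl
  βa₂ : β ∘G a₂ ≃ a₁
  βa₂ = FPBC.universal∘g' F₁ (FPBC.pullback F₂) idG ≃-refl
  i : K₁ ≅ K₂
  i = record
    { to      = α
    ; from    = β
    ; to∘from = FPBC.rigid F₂ (α ∘G β) (l₂α ▹ β ∙ l₁β) (α ◃ βa₂ ∙ αa₁)
    ; from∘to = FPBC.rigid F₁ (β ∘G α) (l₁β ▹ α ∙ l₂α) (β ◃ αa₁ ∙ βa₂)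
    }

record Pushout {A B C P : Graph} (f : A ⇒ B) (g : A ⇒ C) (p : B ⇒ P) (q : C ⇒ P) : Set₁ where
  field
    commute     : p ∘G f ≃ q ∘G g
    universal   : ∀ {X} (x : B ⇒ X) (y : C ⇒ X) → x ∘G f ≃ y ∘G g → P ⇒ X
    universal∘p : ∀ {X} (x : B ⇒ X) (y : C ⇒ X) (c : x ∘G f ≃ y ∘G g) →
                  universal x y c ∘G p ≃ x
    universal∘q : ∀ {X} (x : B ⇒ X) (y : C ⇒ X) (c : x ∘G f ≃ y ∘G g) →
                  universal x y c ∘G q ≃ y
    unique      : ∀ {X} (x : B ⇒ X) (y : C ⇒ X) (c : x ∘G f ≃ y ∘G g) (u : P ⇒ X) →
                  u ∘G p ≃ x → u ∘G q ≃ y → u ≃ universal x y c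

  jointly-epic : ∀ {X} (z z' : P ⇒ X) → z ∘G p ≃ z' ∘G p → z ∘G q ≃ z' ∘G q → z ≃ z'
  jointly-epic z z' e₁ e₂ =
    unique (z ∘G p) (z ∘G q) (z ◃ commute) z ≃-refl ≃-refl
    ∙ ≃-sym (unique (z ∘G p) (z ∘G q) (z ◃ commute) z' (≃-sym e₁) (≃-sym e₂))

module PO = Pushout

module _ {A B C P : Graph} {f : A ⇒ B} {g : A ⇒ C} {p : B ⇒ P} {q : C ⇒ P} where

  IsPushout⇒Pushout : IsPushout f g p q → Pushout f g p q
  IsPushout⇒Pushout (c , univ) = record
    { commute     = ≈G⇒≃ c
    ; universal   = λ x y c → proj₁ (univ x y (≃⇒≈G c))
    ; universal∘p = λ x y c → ≈G⇒≃ (proj₁ (proj₁ (proj₂ (univ x y (≃⇒≈G c)))))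
    ; universal∘q = λ x y c → ≈G⇒≃ (proj₂ (proj₁ (proj₂ (univ x y (≃⇒≈G c)))))
    ; unique      = λ x y c u e₁ e₂ →
                      ≈G⇒≃ (proj₂ (proj₂ (univ x y (≃⇒≈G c))) u (≃⇒≈G e₁) (≃⇒≈G e₂))
    }

  Pushout⇒IsPushout : Pushout f g p q → IsPushout f g p q
  Pushout⇒IsPushout P =
      ≃⇒≈G (PO.commute P)
    , λ x y c → PO.universal P x y (≈G⇒≃ c)
              , (≃⇒≈G (PO.universal∘p P x y (≈G⇒≃ c)) , ≃⇒≈G (PO.universal∘q P x y (≈G⇒≃ c)))
              , λ u e₁ e₂ → ≃⇒≈G (PO.unique P x y (≈G⇒≃ c) u (≈G⇒≃ e₁) (≈G⇒≃ e₂))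

pushout-id : ∀ {A B} (r : A ⇒ B) → Pushout r idG idG r
pushout-id r = record
  { commute     = ≃-refl
  ; universal   = λ x _ _ → x
  ; universal∘p = λ _ _ _ → ≃-refl
  ; universal∘q = λ _ _ c → c
  ; unique      = λ _ _ _ _ e₁ _ → e₁
  }

pushout-glue : ∀ {A B A₁ B₁ A₂ B₂} {r : A ⇒ B} {f₁ : A ⇒ A₁} {h₁ : B ⇒ B₁} {r₁ : A₁ ⇒ B₁}
                 {f₂ : A₁ ⇒ A₂} {h₂ : B₁ ⇒ B₂} {r₂ : A₂ ⇒ B₂} →
               Pushout r f₁ h₁ r₁ → Pushout r₁ f₂ h₂ r₂ → Pushout r (f₂ ∘G f₁) (h₂ ∘G h₁) r₂
pushout-glue {B = B} {B₁ = B₁} {A₂} {r = r} {f₁} {h₁} {r₁} {f₂} {h₂} P₁ P₂ = record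
  { commute     = h₂ ◃ PO.commute P₁ ∙ PO.commute P₂ ▹ f₁
  ; universal   = λ x y c → PO.universal P₂ (left x y c) y (left-r₁ x y c)
  ; universal∘p = λ x y c → PO.universal∘p P₂ (left x y c) y (left-r₁ x y c) ▹ h₁
                            ∙ PO.universal∘p P₁ x (y ∘G f₂) c
  ; universal∘q = λ x y c → PO.universal∘q P₂ (left x y c) y (left-r₁ x y c)
  ; unique      = λ x y c u uh ur →
      PO.unique P₂ (left x y c) y (left-r₁ x y c) u
        (PO.unique P₁ x (y ∘G f₂) c (u ∘G h₂) uh (u ◃ PO.commute P₂ ∙ ur ▹ f₂))
        ur
  }
  where
  module _ {X} (x : B ⇒ X) (y : A₂ ⇒ X) (c : x ∘G r ≃ y ∘G f₂ ∘G f₁) where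
    left : B₁ ⇒ X
    left = PO.universal P₁ x (y ∘G f₂) c

    left-r₁ : left ∘G r₁ ≃ y ∘G f₂
    left-r₁ = PO.universal∘q P₁ x (y ∘G f₂) c

pushout-unique : ∀ {A B K₁ K₂ B₁ B₂} {r : A ⇒ B} {g₁ : A ⇒ K₁} {h₁ : B ⇒ B₁} {r₁ : K₁ ⇒ B₁}
                   {g₂ : A ⇒ K₂} {h₂ : B ⇒ B₂} {r₂ : K₂ ⇒ B₂} →
                 Pushout r g₁ h₁ r₁ → Pushout r g₂ h₂ r₂ →
                 (i : K₁ ≅ K₂) → to i ∘G g₁ ≃ g₂ →
                 Σ[ j ∈ B₁ ≅ B₂ ] (to j ∘G h₁ ≃ h₂) × (to j ∘G r₁ ≃ r₂ ∘G to i)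
pushout-unique {B₁ = B₁} {B₂} {r = r} {g₁} {h₁} {r₁} {g₂} {h₂} {r₂} P₁ P₂ i ig₁ = j , φh₁ , φr₁
  where
  c₁ : h₂ ∘G r ≃ r₂ ∘G to i ∘G g₁
  c₁ = PO.commute P₂ ∙ ≃-sym (r₂ ◃ ig₁)
  c₂ : h₁ ∘G r ≃ r₁ ∘G from i ∘G g₂
  c₂ = PO.commute P₁ ∙ ≃-sym (r₁ ◃ (≃-sym (from i ◃ ig₁) ∙ from∘to i ▹ g₁))
  φ : B₁ ⇒ B₂
  φ = PO.universal P₁ h₂ (r₂ ∘G to i) c₁
  φh₁ : φ ∘G h₁ ≃ h₂
  φh₁ = PO.universal∘p P₁ h₂ (r₂ ∘G to i) c₁
  φr₁ : φ ∘G r₁ ≃ r₂ ∘G to i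
  φr₁ = PO.universal∘q P₁ h₂ (r₂ ∘G to i) c₁
  ψ : B₂ ⇒ B₁
  ψ = PO.universal P₂ h₁ (r₁ ∘G from i) c₂
  ψh₂ : ψ ∘G h₂ ≃ h₁
  ψh₂ = PO.universal∘p P₂ h₁ (r₁ ∘G from i) c₂
  ψr₂ : ψ ∘G r₂ ≃ r₁ ∘G from i
  ψr₂ = PO.universal∘q P₂ h₁ (r₁ ∘G from i) c₂
  j : B₁ ≅ B₂
  j = record
    { to      = φ
    ; from    = ψ
    ; to∘from = PO.jointly-epic P₂ (φ ∘G ψ) idG (φ ◃ ψh₂ ∙ φh₁)
                  (φ ◃ ψr₂ ∙ φr₁ ▹ from i ∙ r₂ ◃ to∘from i)
    ; from∘to = PO.jointly-epic P₁ (ψ ∘G φ) idG (ψ ◃ φh₁ ∙ ψh₂)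
                  (ψ ◃ φr₁ ∙ ψr₂ ▹ to i ∙ r₁ ◃ from∘to i)
    }

-- Point and Arrow represent single nodes and edges, so that the universal
-- property of a pullback can be applied to individual items.
Point : Graph
Point = record { Node = ⊤ ; Edge = ⊥ ; src = λ () ; tgt = λ () }

data Endpoint : Set where
  source target : Endpoint

Arrow : Graph
Arrow = record { Node = Endpoint ; Edge = ⊤ ; src = λ _ → source ; tgt = λ _ → target }

pointAt : ∀ {G} → Node G → Point ⇒ G
pointAt x = record { nmap = λ _ → x ; emap = λ () ; src-comm = λ () ; tgt-comm = λ () }

arrowAt : ∀ {G} → Edge G → Arrow ⇒ G
arrowAt {G} e = record { nmap = λ { source → src G e ; target → tgt G e } ; emap = λ _ → e
                       ; src-comm = λ _ → refl ; tgt-comm = λ _ → refl }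

module _ {K L L₁ K₁} {l : K ⇒ L} {f : L ⇒ L₁} {a : K ⇒ K₁} {l₁ : K₁ ⇒ L₁}
         (pb : Pullback f l₁ l a) where

  pullback-reflects-nodeImage : ∀ {y k₁} → nmap l₁ k₁ ≡ nmap f y → ∃ λ k → nmap l k ≡ y
  pullback-reflects-nodeImage {y} {k₁} e =
    nmap (PB.universal pb (pointAt y) (pointAt k₁) c) tt
    , on-nodes (PB.p∘universal pb (pointAt y) (pointAt k₁) c) tt
    where
    c : f ∘G pointAt y ≃ l₁ ∘G pointAt k₁
    c = pointwise (λ _ → sym e) (λ ())

  pullback-reflects-edgeImage : ∀ {y k₁} → emap l₁ k₁ ≡ emap f y → ∃ λ k → emap l k ≡ y
  pullback-reflects-edgeImage {y} {k₁} e =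
    emap (PB.universal pb (arrowAt y) (arrowAt k₁) c) tt
    , on-edges (PB.p∘universal pb (arrowAt y) (arrowAt k₁) c) tt
    where
    endpoints : ∀ z → nmap f (nmap (arrowAt {L} y) z) ≡ nmap l₁ (nmap (arrowAt {K₁} k₁) z)
    endpoints source = trans (sym (src-comm f y)) (trans (cong (src L₁) (sym e)) (src-comm l₁ k₁))
    endpoints target = trans (sym (tgt-comm f y)) (trans (cong (tgt L₁) (sym e)) (tgt-comm l₁ k₁))
    c : f ∘G arrowAt y ≃ l₁ ∘G arrowAt k₁
    c = pointwise endpoints (λ _ → sym e)

conflictFree-id : ∀ {K L} (l : K ⇒ L) → ConflictFree l idG
conflictFree-id l = (λ (_ , _ , (k , kx) , y∉ , x≡y) → y∉ (k , trans kx x≡y))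
                  , (λ (_ , _ , (k , kx) , y∉ , x≡y) → y∉ (k , trans kx x≡y))

-- The pullback square maps l(K) into l₁(K₁) and maps the complement of l(K)
-- into the complement of l₁(K₁), so a conflict for f₂ ∘ f₁ is one for f₂.
conflictFree-∘ : ∀ {K L L₁ L₂ K₁} {l : K ⇒ L} {f₁ : L ⇒ L₁} {a₁ : K ⇒ K₁} {l₁ : K₁ ⇒ L₁}
                   {f₂ : L₁ ⇒ L₂} →
                 Pullback f₁ l₁ l a₁ → ConflictFree l₁ f₂ → ConflictFree l (f₂ ∘G f₁)
conflictFree-∘ {f₁ = f₁} {a₁} pb (no-node-conflict , no-edge-conflict) =
    (λ (x , y , (k , kx) , y∉ , fx≡fy) →
       no-node-conflict
         ( nmap f₁ x , nmap f₁ y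
         , (nmap a₁ k , trans (sym (on-nodes (PB.commute pb) k)) (cong (nmap f₁) kx))
         , (λ (_ , e) → y∉ (pullback-reflects-nodeImage pb e)) , fx≡fy))
  , (λ (x , y , (k , kx) , y∉ , fx≡fy) →
       no-edge-conflict
         ( emap f₁ x , emap f₁ y
         , (emap a₁ k , trans (sym (on-edges (PB.commute pb) k)) (cong (emap f₁) kx))
         , (λ (_ , e) → y∉ (pullback-reflects-edgeImage pb e)) , fx≡fy))

module FpbcFunctoriality
  (D M : WideSub)
  (Dom : ∀ {K L L₁} → K ⇒ L → L ⇒ L₁ → Set)
  (Dom-id : ∀ {K L} (l : K ⇒ L) → Dom l idG)
  (Dom-∘ : ∀ {K L L₁ L₂ K₁} {l : K ⇒ L} {f₁ : L ⇒ L₁} {a₁ : K ⇒ K₁} {l₁ : K₁ ⇒ L₁}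
             {f₂ : L₁ ⇒ L₂} → Pullback f₁ l₁ l a₁ → Dom l₁ f₂ → Dom l (f₂ ∘G f₁))
  (iso∈M : ∀ {G H} (i : G ≅ H) → Mor M (to i))
  where

  𝓡 : CRS
  𝓡 = fpbcSystem D M Dom

  𝓢 : CRS
  𝓢 = 𝓡 ⨾ 𝓡po

  open CRS 𝓡 using () renaming (idP to idᴿ; _∘P_ to _∘ᴿ_)
  open CRS 𝓢 using () renaming (idP to idˢ; _∘P_ to _∘ˢ_)
  open CompRule
  open CompHom

  ruleIso : ∀ {L} {ρ₁ ρ₂ : ARule D L} (i : K ρ₁ ≅ K ρ₂) → l ρ₁ ≃ l ρ₂ ∘G to i →
            AHom D M ρ₁ ρ₂ idG
  ruleIso i li = record { a = to i ; a∈M = iso∈M i ; f∈M = Mor-id M ; comm = ≃⇒≈G li }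

  fpbc-upToIso : ∀ {L L₁} {ρ : ARule D L} {ρ₁ ρ₂ : ARule D L₁} {f : L ⇒ L₁}
                   (π₁ : AHom D M ρ ρ₁ f) (π₂ : AHom D M ρ ρ₂ f) →
                 FinalPullbackComplement (l ρ) f (a π₁) (l ρ₁) →
                 FinalPullbackComplement (l ρ) f (a π₂) (l ρ₂) →
                 UpToIso 𝓡 π₁ π₂
  fpbc-upToIso {ρ₁ = ρ₁} {ρ₂} π₁ π₂ F₁ F₂ with fpbc-unique F₁ F₂
  ... | i , li , ia =
      ruleIso i li , ruleIso (≅-sym i) (transpose-square i ≅-refl {l ρ₁} {l ρ₂} li)
    , (≃⇒≈G ≃-refl , ≃⇒≈G (to∘from i))
    , (≃⇒≈G ≃-refl , ≃⇒≈G (from∘to i))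
    , (≃⇒≈G ≃-refl , ≃⇒≈G ia)

  functorial : Functorial 𝓡
  functorial = identity , composition
    where
    identity : FunctorialI 𝓡
    identity ρ =
        (ρ , idᴿ , Dom-id (l ρ) , FinalPullbackComplement⇒IsFPBC (fpbc-id (l ρ)))
      , λ _ π (_ , F) → fpbc-upToIso π idᴿ (IsFPBC⇒FinalPullbackComplement F) (fpbc-id (l ρ))

    composition : FunctorialII 𝓡
    composition ρ ρ₁ ρ₂ f₁ f₂ π₁ π₂ (_ , F₁) (d₂ , F₂) =
        (ρ₂ , π₂ ∘ᴿ π₁ , Dom-∘ (FPBC.pullback G₁) d₂ , FinalPullbackComplement⇒IsFPBC G₁₂)
      , λ _ π₃ (_ , F₃) → fpbc-upToIso (π₂ ∘ᴿ π₁) π₃ G₁₂ (IsFPBC⇒FinalPullbackComplement F₃)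
      where
      G₁ : FinalPullbackComplement (l ρ) f₁ (a π₁) (l ρ₁)
      G₁ = IsFPBC⇒FinalPullbackComplement F₁
      G₂ : FinalPullbackComplement (l ρ₁) f₂ (a π₂) (l ρ₂)
      G₂ = IsFPBC⇒FinalPullbackComplement F₂
      G₁₂ : FinalPullbackComplement (l ρ) (f₂ ∘G f₁) (a π₂ ∘G a π₁) (l ρ₂)
      G₁₂ = fpbc-glue G₁ G₂

  sqpoRuleIso : ∀ {L} {ρ₁ ρ₂ : CompRule 𝓡 𝓡po L}
                  (i : K (fst ρ₁) ≅ K (fst ρ₂)) (j : B (snd ρ₁) ≅ B (snd ρ₂)) →
                l (fst ρ₁) ≃ l (fst ρ₂) ∘G to i → to j ∘G r (snd ρ₁) ≃ r (snd ρ₂) ∘G to i →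
                CompHom 𝓡 𝓡po ρ₁ ρ₂ idG
  sqpoRuleIso i j li rj = record
    { hfst = ruleIso i li
    ; f'   = to i
    ; f'≈  = ≈G-refl
    ; hsnd = record { h = to j ; pcomm = ≃⇒≈G rj }
    }

  f'-along-iso : ∀ {L L₁} {ρ : CompRule 𝓡 𝓡po L} {ρ₁ ρ₂ : CompRule 𝓡 𝓡po L₁} {f : L ⇒ L₁}
                   (π₁ : CompHom 𝓡 𝓡po ρ ρ₁ f) (π₂ : CompHom 𝓡 𝓡po ρ ρ₂ f)
                   (i : K (fst ρ₁) ≅ K (fst ρ₂)) →
                 to i ∘G a (hfst π₁) ≃ a (hfst π₂) → to i ∘G f' π₁ ≃ f' π₂
  f'-along-iso π₁ π₂ i ia = to i ◃ ≈G⇒≃ (f'≈ π₁) ∙ ia ∙ ≃-sym (≈G⇒≃ (f'≈ π₂))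

  sqpo-upToIso : ∀ {L L₁} {ρ : CompRule 𝓡 𝓡po L} {ρ₁ ρ₂ : CompRule 𝓡 𝓡po L₁} {f : L ⇒ L₁}
                   (π₁ : CompHom 𝓡 𝓡po ρ ρ₁ f) (π₂ : CompHom 𝓡 𝓡po ρ ρ₂ f) →
                 FinalPullbackComplement (l (fst ρ)) f (a (hfst π₁)) (l (fst ρ₁)) →
                 Pushout (r (snd ρ)) (f' π₁) (h (hsnd π₁)) (r (snd ρ₁)) →
                 FinalPullbackComplement (l (fst ρ)) f (a (hfst π₂)) (l (fst ρ₂)) →
                 Pushout (r (snd ρ)) (f' π₂) (h (hsnd π₂)) (r (snd ρ₂)) →
                 UpToIso 𝓢 π₁ π₂
  sqpo-upToIso {ρ₁ = ρ₁} {ρ₂} π₁ π₂ F₁ P₁ F₂ P₂ with fpbc-unique F₁ F₂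
  ... | i , li , ia with pushout-unique P₁ P₂ i (f'-along-iso π₁ π₂ i ia)
  ... | j , jh , rj =
      sqpoRuleIso i j li rj
    , sqpoRuleIso (≅-sym i) (≅-sym j) (transpose-square i ≅-refl {l (fst ρ₁)} {l (fst ρ₂)} li)
                  (transpose-square i j {r (snd ρ₁)} {r (snd ρ₂)} rj)
    , ((≃⇒≈G ≃-refl , ≃⇒≈G (to∘from i)) , (≃⇒≈G (to∘from i) , ≃⇒≈G (to∘from j)))
    , ((≃⇒≈G ≃-refl , ≃⇒≈G (from∘to i)) , (≃⇒≈G (from∘to i) , ≃⇒≈G (from∘to j)))
    , ((≃⇒≈G ≃-refl , ≃⇒≈G ia)
      , (≃⇒≈G (f'-along-iso π₁ π₂ i ia) , ≃⇒≈G jh))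

  sqpo-functorial : Functorial 𝓢
  sqpo-functorial = identity , composition
    where
    identity : FunctorialI 𝓢
    identity ρ =
        ( ρ , idˢ
        , (Dom-id (l (fst ρ)) , FinalPullbackComplement⇒IsFPBC (fpbc-id (l (fst ρ))))
        , Pushout⇒IsPushout (pushout-id (r (snd ρ))))
      , λ _ π ((_ , F) , P) →
          sqpo-upToIso π idˢ (IsFPBC⇒FinalPullbackComplement F) (IsPushout⇒Pushout P)
            (fpbc-id (l (fst ρ))) (pushout-id (r (snd ρ)))

    composition : FunctorialII 𝓢
    composition ρ ρ₁ ρ₂ f₁ f₂ π₁ π₂ ((_ , F₁) , P₁) ((d₂ , F₂) , P₂) =
        ( ρ₂ , π₂ ∘ˢ π₁
        , (Dom-∘ (FPBC.pullback G₁) d₂ , FinalPullbackComplement⇒IsFPBC G₁₂)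
        , Pushout⇒IsPushout Q₁₂)
      , λ _ π₃ ((_ , F₃) , P₃) →
          sqpo-upToIso (π₂ ∘ˢ π₁) π₃ G₁₂ Q₁₂
            (IsFPBC⇒FinalPullbackComplement F₃) (IsPushout⇒Pushout P₃)
      where
      G₁ : FinalPullbackComplement (l (fst ρ)) f₁ (a (hfst π₁)) (l (fst ρ₁))
      G₁ = IsFPBC⇒FinalPullbackComplement F₁
      G₂ : FinalPullbackComplement (l (fst ρ₁)) f₂ (a (hfst π₂)) (l (fst ρ₂))
      G₂ = IsFPBC⇒FinalPullbackComplement F₂
      G₁₂ : FinalPullbackComplement (l (fst ρ)) (f₂ ∘G f₁) (a (hfst π₂) ∘G a (hfst π₁)) (l (fst ρ₂))
      G₁₂ = fpbc-glue G₁ G₂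
      Q₁ : Pushout (r (snd ρ)) (f' π₁) (h (hsnd π₁)) (r (snd ρ₁))
      Q₁ = IsPushout⇒Pushout P₁
      Q₂ : Pushout (r (snd ρ₁)) (f' π₂) (h (hsnd π₂)) (r (snd ρ₂))
      Q₂ = IsPushout⇒Pushout P₂
      Q₁₂ : Pushout (r (snd ρ)) (f' π₂ ∘G f' π₁) (h (hsnd π₂) ∘G h (hsnd π₁)) (r (snd ρ₂))
      Q₁₂ = pushout-glue Q₁ Q₂

module Injective-rules =
  FpbcFunctoriality InjG AllG ConflictFree conflictFree-id
    (λ {f₂ = f₂} pb → conflictFree-∘ {f₂ = f₂} pb) (λ _ → tt)

module Injective-matches =
  FpbcFunctoriality AllG InjG (λ _ _ → ⊤) (λ _ → tt) (λ _ _ → tt) to-injective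

proposition3p11 : (Functorial 𝓡fpbc₁ × Functorial 𝓡sqpo₁) × (Functorial 𝓡fpbc₂ × Functorial 𝓡sqpo₂)
proposition3p11 = (Injective-rules.functorial , Injective-rules.sqpo-functorial)
                , (Injective-matches.functorial , Injective-matches.sqpo-functorial)
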